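{- Let $R$ be an integral domain with unit, $p,q\in R$, let $U=(U_n)_{n\ge0}$ be defined by $U_0=0$, $U_1=1$, $U_n=pU_{n-1}-qU_{n-2}$ for $n\ge2$, and set $x_n=U_n/U_{n-1}$ for $n\ge2$. Then for all integers $n\ge2$ and $m\ge1$ (whenever the quotients involved are defined in the field of fractions of $R$), $$x_{n+m}=\frac{x_{m+1}x_n-q}{x_n+x_{m+1}-p}.$$
   Context: All quotients are taken in the field of fractions of $R$. -}

module Defs where

open import Level using (_⊔_)
open import Data.Nat using (ℕ; zero; suc)
open import Data.Sum using (_⊎_; inj₁; inj₂)
open import Data.Product using (_×_)
open import Relation.Nullary using (¬_)
open import Algebra.Bundles using (CommutativeRing)

record IsIntegralDomain {c ℓ} (R : CommutativeRing c ℓ) : Set (c ⊔ ℓ) where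
  open CommutativeRing R
  field
    1≉0            : ¬ (1# ≈ 0#)
    noZeroDivisors : ∀ x y → x * y ≈ 0# → x ≈ 0# ⊎ y ≈ 0#

module Lucas {c ℓ} (R : CommutativeRing c ℓ) (p q : CommutativeRing.Carrier R) where
  open CommutativeRing R
  U : ℕ → Carrier
  U zero = 0#
  U (suc zero) = 1#
  U (suc (suc n)) = p * U (suc n) + - (q * U n)

module FieldOfFractions {c ℓ} (R : CommutativeRing c ℓ) (D : IsIntegralDomain R) where
  open CommutativeRing R
  open IsIntegralDomain D

  NonZero : Carrier → Set ℓ
  NonZero x = ¬ (x ≈ 0#)

  *-nonZero : ∀ {x y} → NonZero x → NonZero y → NonZero (x * y)
  *-nonZero {x} {y} nx ny e with noZeroDivisors x y e
  ... | inj₁ a = nx a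
  ... | inj₂ b = ny b

  record Frac : Set (c ⊔ ℓ) where
    constructor frac
    field
      num    : Carrier
      den    : Carrier
      den≉0  : NonZero den
  open Frac public

  infix 4 _≃_
  _≃_ : Frac → Frac → Set ℓ
  x ≃ y = num x * den y ≈ num y * den x

  ι : Carrier → Frac
  ι r = frac r 1# 1≉0

  infixl 6 _⊕_ _⊖_
  infixl 7 _⊗_
  _⊕_ : Frac → Frac → Frac
  x ⊕ y = frac (num x * den y + num y * den x) (den x * den y)
               (*-nonZero (den≉0 x) (den≉0 y))

  ⊝_ : Frac → Frac
  ⊝ x = frac (- num x) (den x) (den≉0 x)

  _⊖_ : Frac → Frac → Frac
  x ⊖ y = x ⊕ (⊝ y)

  _⊗_ : Frac → Frac → Frac
  x ⊗ y = frac (num x * num y) (den x * den y) (*-nonZero (den≉0 x) (den≉0 y))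

  -- a fraction is zero iff its numerator is zero
  Frac≉0 : Frac → Set ℓ
  Frac≉0 x = NonZero (num x)

  div : (x y : Frac) → Frac≉0 y → Frac
  div x y ny = frac (num x * den y) (den x * num y) (*-nonZero (den≉0 x) ny)

  quot : (a b : Carrier) → NonZero b → Frac
  quot a b nb = frac a b nb

module Submission where

-- After clearing denominators this is a consequence of the addition law
--     U_{m+n} = U_n U_{m+1} - q U_{n-1} U_m                      (n ≥ 1).
-- We prove the addition law by noting that, for fixed n, both sides are
-- sequences in m obeying the Lucas recurrence and agree for m = 0, 1;
-- such a sequence is determined by its first two terms.  Using the
-- recurrence once more gives the companion identity
--     U_{m+n-1} = U_n U_m + U_{n-1} U_{m+1} - p U_{n-1} U_m.
-- In the field of fractions, x_{m+1} x_n - q and x_n + x_{m+1} - p have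
-- the common denominator U_{n-1} U_m, with numerators given by the right
-- hand sides of these two identities; the theorem then follows from the
-- fact that a quotient of two fractions with equal denominators is the
-- quotient of their numerators.

open import Defs
open import Level using (Level)
open import Data.Nat using (ℕ; zero; suc; _+_; _∸_; _≤_; s≤s)
open import Algebra.Bundles using (CommutativeRing)
open import Data.Nat.Properties using (+-comm; +-suc)
import Relation.Binary.PropositionalEquality as ≡
import Algebra.Solver.Ring.NaturalCoefficients.Default as Solver
import Algebra.Properties.Ring as RingProperties
import Relation.Binary.Reasoning.Setoid as SetoidReasoning

module LucasIdentities {c ℓ} (R : CommutativeRing c ℓ) (p q : CommutativeRing.Carrier R) where
  open CommutativeRing R renaming (_+_ to _⊞_)
  open Lucas R p q
  open Solver commutativeSemiring
  open RingProperties ring using (-‿distribˡ-*)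
  open SetoidReasoning setoid

  -- Keeping the sign inside it
  -- makes the identities below identities of commutative semirings in
  -- p, Q and the terms, which the semiring solver normalises.
  Q : Carrier
  Q = - q

  Recurrent : (ℕ → Carrier) → Set ℓ
  Recurrent s = ∀ n → s (suc (suc n)) ≈ p * s (suc n) ⊞ Q * s n

  U-recurrent : Recurrent U
  U-recurrent n = +-cong refl (-‿distribˡ-* q (U n))

  recurrent-unique : ∀ {s t} → Recurrent s → Recurrent t →
                     s 0 ≈ t 0 → s 1 ≈ t 1 → ∀ n → s n ≈ t n
  recurrent-unique rs rt e₀ e₁ zero = e₀
  recurrent-unique rs rt e₀ e₁ (suc zero) = e₁
  recurrent-unique {s} {t} rs rt e₀ e₁ (suc (suc n)) = begin
    s (suc (suc n))          ≈⟨ rs n ⟩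
    p * s (suc n) ⊞ Q * s n  ≈⟨ +-cong (*-cong refl (recurrent-unique rs rt e₀ e₁ (suc n)))
                                       (*-cong refl (recurrent-unique rs rt e₀ e₁ n)) ⟩
    p * t (suc n) ⊞ Q * t n  ≈⟨ rt n ⟨
    t (suc (suc n))          ∎

  shift-recurrent : ∀ {s} k → Recurrent s → Recurrent (λ n → s (n + k))
  shift-recurrent k rs n = rs (n + k)

  suc-recurrent : ∀ {s} → Recurrent s → Recurrent (λ n → s (suc n))
  suc-recurrent rs n = rs (suc n)

  combination-recurrent : ∀ {s t} (a b : Carrier) → Recurrent s → Recurrent t →
                          Recurrent (λ n → a * s n ⊞ b * t n)
  combination-recurrent {s} {t} a b rs rt n = begin
    a * s (suc (suc n)) ⊞ b * t (suc (suc n))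
      ≈⟨ +-cong (*-cong refl (rs n)) (*-cong refl (rt n)) ⟩
    a * (p * s₁ ⊞ Q * s₀) ⊞ b * (p * t₁ ⊞ Q * t₀)
      ≈⟨ solve 8 (λ a b p Q s₁ s₀ t₁ t₀ →
                    a :* (p :* s₁ :+ Q :* s₀) :+ b :* (p :* t₁ :+ Q :* t₀)
                 := p :* (a :* s₁ :+ b :* t₁) :+ Q :* (a :* s₀ :+ b :* t₀))
               refl a b p Q s₁ s₀ t₁ t₀ ⟩
    p * (a * s₁ ⊞ b * t₁) ⊞ Q * (a * s₀ ⊞ b * t₀) ∎
    where
    s₁ s₀ t₁ t₀ : Carrier
    s₁ = s (suc n)
    s₀ = s n
    t₁ = t (suc n)
    t₀ = t n

  U-add : ∀ m j → U (m + suc j) ≈ U (suc j) * U (suc m) ⊞ Q * U j * U m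
  U-add m j =
    recurrent-unique (shift-recurrent (suc j) U-recurrent)
                     (combination-recurrent (U (suc j)) (Q * U j)
                                            (suc-recurrent U-recurrent) U-recurrent)
                     at-0 at-1 m
    where
    at-0 : U (suc j) ≈ U (suc j) * 1# ⊞ Q * U j * 0#
    at-0 = solve 3 (λ x y Q → x := x :* con 1 :+ Q :* y :* con 0) refl (U (suc j)) (U j) Q

    at-1 : U (suc (suc j)) ≈ U (suc j) * U 2 ⊞ Q * U j * 1#
    at-1 = begin
      U (suc (suc j))          ≈⟨ U-recurrent j ⟩
      p * U (suc j) ⊞ Q * U j
        ≈⟨ solve 4 (λ x y p Q → p :* x :+ Q :* y
                              := x :* (p :* con 1 :+ Q :* con 0) :+ Q :* y :* con 1)
                   refl (U (suc j)) (U j) p Q ⟩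
      U (suc j) * (p * 1# ⊞ Q * 0#) ⊞ Q * U j * 1#
        ≈⟨ +-cong (*-cong refl (U-recurrent 0)) refl ⟨
      U (suc j) * U 2 ⊞ Q * U j * 1#  ∎

  -- The companion law  U_{m+n-1} = U_n U_m + U_{n-1} U_{m+1} - p U_{n-1} U_m
  -- for n = j + 1 and m = i + 1: expand U_{m+1} by the recurrence in the
  -- addition law for U_{i + n}; the terms ± p U_{n-1} U_m cancel.
  U-add-pred : ∀ i j → U (i + suc j) ≈
               U (suc j) * U (suc i) ⊞ U j * U (suc (suc i)) ⊞ (- p) * (U j * U (suc i))
  U-add-pred i j = begin
    U (i + suc j)                           ≈⟨ U-add i j ⟩
    a * d ⊞ Q * b * e                       ≈⟨ +-identityʳ _ ⟨
    a * d ⊞ Q * b * e ⊞ 0#                  ≈⟨ +-cong refl p-cancels ⟨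
    a * d ⊞ Q * b * e ⊞ (p ⊞ - p) * (b * d)
      ≈⟨ solve 7 (λ a b d e p P Q →
                    a :* d :+ Q :* b :* e :+ (p :+ P) :* (b :* d)
                 := a :* d :+ b :* (p :* d :+ Q :* e) :+ P :* (b :* d))
               refl a b d e p (- p) Q ⟩
    a * d ⊞ b * (p * d ⊞ Q * e) ⊞ (- p) * (b * d)
      ≈⟨ +-cong (+-cong refl (*-cong refl (U-recurrent i))) refl ⟨
    a * d ⊞ b * U (suc (suc i)) ⊞ (- p) * (b * d)  ∎
    where
    a b d e : Carrier
    a = U (suc j)
    b = U j
    d = U (suc i)
    e = U i
    p-cancels : (p ⊞ - p) * (b * d) ≈ 0#
    p-cancels = trans (*-cong (-‿inverseʳ p) refl) (zeroˡ _)

module FractionLemmas {c ℓ} (R : CommutativeRing c ℓ) (D : IsIntegralDomain R) where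
  open CommutativeRing R
  open FieldOfFractions R D
  open SetoidReasoning setoid

  quot-div : ∀ {x y} (hy : NonZero y) (u v : Frac) (hv : Frac≉0 v) →
             den u ≈ den v → x ≈ num u → y ≈ num v → quot x y hy ≃ div u v hv
  quot-div {x} {y} hy u v hv same-den x≈u y≈v = begin
    x * (den u * num v)      ≈⟨ *-cong x≈u (*-cong same-den refl) ⟩
    num u * (den v * num v)  ≈⟨ *-assoc (num u) (den v) (num v) ⟨
    num u * den v * num v    ≈⟨ *-cong refl y≈v ⟨
    num u * den v * y        ∎

corollary2p4 : ∀ {c ℓ : Level} (R : CommutativeRing c ℓ) (D : IsIntegralDomain R)
    (p q : CommutativeRing.Carrier R) (n m : ℕ) → 2 ≤ n → 1 ≤ m →
    let open Lucas R p q
        open FieldOfFractions R D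
    in (hn : NonZero (U (n ∸ 1))) (hm : NonZero (U m)) (hnm : NonZero (U (n + m ∸ 1))) →
    let xn = quot (U n) (U (n ∸ 1)) hn
        xm1 = quot (U (suc m)) (U m) hm
        xnm = quot (U (n + m)) (U (n + m ∸ 1)) hnm
    in (hden : Frac≉0 (xn ⊕ xm1 ⊖ ι p)) →
    xnm ≃ div (xm1 ⊗ xn ⊖ ι q) (xn ⊕ xm1 ⊖ ι p) hden
corollary2p4 R D p q (suc (suc k)) (suc i) (s≤s (s≤s _)) (s≤s _) hn hm hnm hden =
  quot-div hnm (xm1 ⊗ xn ⊖ ι q) (xn ⊕ xm1 ⊖ ι p) hden
           (*-cong (*-comm d b) refl) product-numerator sum-numerator
  where
  open CommutativeRing R using (Carrier; _≈_; _*_; -_; 1#; refl; trans; reflexive; *-cong; *-comm)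
    renaming (_+_ to _⊞_)
  open Lucas R p q
  open LucasIdentities R p q
  open FieldOfFractions R D
  open FractionLemmas R D
  open Solver (CommutativeRing.commutativeSemiring R)

  -- n = k + 2 and m = i + 1;  x_n = a / b and x_{m+1} = c / d
  a b c d : Carrier
  a = U (suc (suc k))
  b = U (suc k)
  c = U (suc (suc i))
  d = U (suc i)
  xn xm1 : Frac
  xn = quot a b hn
  xm1 = quot c d hm

  -- U_{n+m} is the numerator of x_{m+1} x_n - q, by the addition law
  -- applied after rewriting the index n + m as m + n.
  product-numerator : U (suc (suc k) + suc i) ≈ c * a * 1# ⊞ (- q) * (d * b)
  product-numerator =
    trans (reflexive (≡.cong U (+-comm (suc (suc k)) (suc i))))
    (trans (U-add (suc i) (suc k))
           (solve 5 (λ a b c d Q → a :* c :+ Q :* b :* d := c :* a :* con 1 :+ Q :* (d :* b))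
                  refl a b c d (- q)))

  -- U_{n+m-1} is the numerator of x_n + x_{m+1} - p, by the companion law
  -- applied after rewriting the index n + m - 1 as i + n.
  sum-numerator : U (suc (k + suc i)) ≈ (a * d ⊞ c * b) * 1# ⊞ (- p) * (b * d)
  sum-numerator =
    trans (reflexive (≡.cong U (≡.trans (≡.cong suc (+-suc k i)) (+-comm (suc (suc k)) i))))
    (trans (U-add-pred i (suc k))
           (solve 5 (λ a b c d P → a :* d :+ b :* c :+ P :* (b :* d)
                                 := (a :* d :+ c :* b) :* con 1 :+ P :* (b :* d))
                  refl a b c d (- p)))
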